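{- Let $\mathcal C$ be a symmetric monoidal closed category with zero morphisms, and let $D$ be an object with morphisms $\iota_i:1\to D$ ($i\in\mathbb N$). Let $\pi_i=\mathrm{ev}_{D,X}\circ((D\multimap X)\otimes\iota_i)\circ\rho^{ -1}_{D\multimap X}:(D\multimap X)\to X$. The following are equivalent: (1) the $\iota_i$ are jointly epic; (2) for every object $X$, the morphisms $X\otimes\iota_i:X\otimes1\to X\otimes D$ are jointly epic; (3) for every object $X$, the morphisms $\pi_i:(D\multimap X)\to X$ are jointly monic.
   Context: $1$ is the monoidal unit, $\rho_X:X\otimes1\to X$ the right unitor, $\mathrm{ev}_{D,X}:(D\multimap X)\otimes D\to X$ the evaluation of the internal hom. A family $(g_i)$ of morphisms with common codomain (resp. domain) is jointly epic (resp. jointly monic) if $f\circ g_i=f'\circ g_i$ for all $i$ implies $f=f'$ (resp. $g_i\circ f=g_i\circ f'$ for all $i$ implies $f=f'$). -}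

module Defs where

open import Level using (Level; _⊔_; suc)
open import Data.Nat using (ℕ)
open import Relation.Binary using (IsEquivalence)

record SymmetricMonoidalClosedCategory (o ℓ e : Level) : Set (suc (o ⊔ ℓ ⊔ e)) where
  infixr 9 _∘_
  infix  3 _⇒_
  infix  4 _≈_
  infixr 10 _⊗₀_ _⊗₁_
  infixr 5 _⊸_
  field
    Obj  : Set o
    _⇒_  : Obj → Obj → Set ℓ
    _≈_  : ∀ {A B} → (A ⇒ B) → (A ⇒ B) → Set e
    id   : ∀ {A} → A ⇒ A
    _∘_  : ∀ {A B C} → (B ⇒ C) → (A ⇒ B) → (A ⇒ C)
    equiv     : ∀ {A B} → IsEquivalence (_≈_ {A} {B})
    ∘-resp-≈  : ∀ {A B C} {f h : B ⇒ C} {g i : A ⇒ B} → f ≈ h → g ≈ i → f ∘ g ≈ h ∘ i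
    assoc     : ∀ {A B C D} {f : A ⇒ B} {g : B ⇒ C} {h : C ⇒ D} → (h ∘ g) ∘ f ≈ h ∘ (g ∘ f)
    identityˡ : ∀ {A B} {f : A ⇒ B} → id ∘ f ≈ f
    identityʳ : ∀ {A B} {f : A ⇒ B} → f ∘ id ≈ f
    unit  : Obj
    _⊗₀_  : Obj → Obj → Obj
    _⊗₁_  : ∀ {A B C D} → (A ⇒ B) → (C ⇒ D) → (A ⊗₀ C ⇒ B ⊗₀ D)
    ⊗-identity : ∀ {A B} → id {A} ⊗₁ id {B} ≈ id
    ⊗-homomorphism : ∀ {A B C D E F} {f : A ⇒ B} {g : B ⇒ C} {h : D ⇒ E} {k : E ⇒ F}
                     → (g ∘ f) ⊗₁ (k ∘ h) ≈ (g ⊗₁ k) ∘ (f ⊗₁ h)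
    ⊗-resp-≈ : ∀ {A B C D} {f f′ : A ⇒ B} {g g′ : C ⇒ D} → f ≈ f′ → g ≈ g′ → f ⊗₁ g ≈ f′ ⊗₁ g′
    λ⇒ : ∀ {A} → unit ⊗₀ A ⇒ A
    λ⇐ : ∀ {A} → A ⇒ unit ⊗₀ A
    λ-isoˡ : ∀ {A} → λ⇐ ∘ λ⇒ ≈ id {unit ⊗₀ A}
    λ-isoʳ : ∀ {A} → λ⇒ ∘ λ⇐ ≈ id {A}
    λ-natural : ∀ {A B} {f : A ⇒ B} → λ⇒ ∘ (id ⊗₁ f) ≈ f ∘ λ⇒
    ρ⇒ : ∀ {A} → A ⊗₀ unit ⇒ A
    ρ⇐ : ∀ {A} → A ⇒ A ⊗₀ unit
    ρ-isoˡ : ∀ {A} → ρ⇐ ∘ ρ⇒ ≈ id {A ⊗₀ unit}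
    ρ-isoʳ : ∀ {A} → ρ⇒ ∘ ρ⇐ ≈ id {A}
    ρ-natural : ∀ {A B} {f : A ⇒ B} → ρ⇒ ∘ (f ⊗₁ id) ≈ f ∘ ρ⇒
    α⇒ : ∀ {A B C} → (A ⊗₀ B) ⊗₀ C ⇒ A ⊗₀ (B ⊗₀ C)
    α⇐ : ∀ {A B C} → A ⊗₀ (B ⊗₀ C) ⇒ (A ⊗₀ B) ⊗₀ C
    α-isoˡ : ∀ {A B C} → α⇐ ∘ α⇒ ≈ id {(A ⊗₀ B) ⊗₀ C}
    α-isoʳ : ∀ {A B C} → α⇒ ∘ α⇐ ≈ id {A ⊗₀ (B ⊗₀ C)}
    α-natural : ∀ {A A′ B B′ C C′} {f : A ⇒ A′} {g : B ⇒ B′} {h : C ⇒ C′}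
                → α⇒ ∘ ((f ⊗₁ g) ⊗₁ h) ≈ (f ⊗₁ (g ⊗₁ h)) ∘ α⇒
    triangle : ∀ {A B} → (id {A} ⊗₁ λ⇒ {B}) ∘ α⇒ ≈ ρ⇒ ⊗₁ id
    pentagon : ∀ {A B C D} → (id {A} ⊗₁ α⇒ {B} {C} {D}) ∘ (α⇒ ∘ (α⇒ ⊗₁ id))
                             ≈ α⇒ ∘ α⇒
    σ : ∀ {A B} → A ⊗₀ B ⇒ B ⊗₀ A
    σ-natural : ∀ {A A′ B B′} {f : A ⇒ A′} {g : B ⇒ B′} → σ ∘ (f ⊗₁ g) ≈ (g ⊗₁ f) ∘ σ
    σ-involutive : ∀ {A B} → σ {B} {A} ∘ σ {A} {B} ≈ id
    hexagon : ∀ {A B C} → (id {B} ⊗₁ σ {A} {C}) ∘ (α⇒ ∘ (σ {A} {B} ⊗₁ id {C}))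
                          ≈ α⇒ ∘ (σ {A} {B ⊗₀ C} ∘ α⇒)
    _⊸_   : Obj → Obj → Obj
    ev    : ∀ {A B} → (A ⊸ B) ⊗₀ A ⇒ B
    curry : ∀ {A B C} → (C ⊗₀ A ⇒ B) → (C ⇒ A ⊸ B)
    curry-β : ∀ {A B C} {f : C ⊗₀ A ⇒ B} → ev ∘ (curry f ⊗₁ id) ≈ f
    curry-unique : ∀ {A B C} {f : C ⊗₀ A ⇒ B} {g : C ⇒ A ⊸ B}
                   → ev ∘ (g ⊗₁ id) ≈ f → g ≈ curry f

record ZeroMorphisms {o ℓ e} (𝒞 : SymmetricMonoidalClosedCategory o ℓ e) : Set (o ⊔ ℓ ⊔ e) where
  open SymmetricMonoidalClosedCategory 𝒞
  field
    zero⇒ : ∀ {A B} → A ⇒ B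
    zero-∘ˡ : ∀ {A B C} {f : B ⇒ C} → f ∘ zero⇒ {A} {B} ≈ zero⇒
    zero-∘ʳ : ∀ {A B C} {g : A ⇒ B} → zero⇒ {B} {C} ∘ g ≈ zero⇒

module _ {o ℓ e} (𝒞 : SymmetricMonoidalClosedCategory o ℓ e) where
  open SymmetricMonoidalClosedCategory 𝒞

  JointlyEpic : ∀ {A B} → (ℕ → A ⇒ B) → Set (o ⊔ ℓ ⊔ e)
  JointlyEpic {B = B} g = ∀ {Z} (f f′ : B ⇒ Z) → (∀ i → f ∘ g i ≈ f′ ∘ g i) → f ≈ f′

  JointlyMonic : ∀ {A B} → (ℕ → A ⇒ B) → Set (o ⊔ ℓ ⊔ e)
  JointlyMonic {A = A} g = ∀ {Z} (f f′ : Z ⇒ A) → (∀ i → g i ∘ f ≈ g i ∘ f′) → f ≈ f′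

  π : ∀ {D} (X : Obj) → (ℕ → unit ⇒ D) → ℕ → (D ⊸ X) ⇒ X
  π X ι i = ev ∘ ((id ⊗₁ ι i) ∘ ρ⇐)

module Submission where

open import Defs
open import Data.Nat using (ℕ)
open import Data.Product using (_×_; _,_)
open import Function.Bundles using (_⇔_; mk⇔)
import Function.Properties.Equivalence as ⇔
open import Relation.Binary.Bundles using (Setoid)
import Relation.Binary.Reasoning.Setoid as SetoidReasoning

-- Each condition is carried to the next along a bijection of hom-sets that
-- moves the relevant family along.  Currying f : X ⊗ D → Z after the symmetry
-- gives D → (X ⊸ Z) and turns f ∘ (X ⊗ ι_i) into (that transpose) ∘ ι_i, so
-- (1) ⇒ (2); taking X = 1 recovers (1).  Uncurrying g : Z → (D ⊸ X) turns
-- π_i ∘ g into uncurry g ∘ (Z ⊗ ι_i) ∘ ρ⁻¹, so (2) ⇔ (3).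

module Properties {o ℓ e} (𝒞 : SymmetricMonoidalClosedCategory o ℓ e) where
  open SymmetricMonoidalClosedCategory 𝒞

  hom-setoid : Obj → Obj → Setoid ℓ e
  hom-setoid A B = record { Carrier = A ⇒ B ; _≈_ = _≈_ ; isEquivalence = equiv }

  module HomSetoid {A B : Obj} = Setoid (hom-setoid A B)
  module HomReasoning {A B : Obj} = SetoidReasoning (hom-setoid A B)
  open HomSetoid using (refl; sym; trans)
  open HomReasoning

  ∘-resp-≈ˡ : ∀ {A B C} {f h : B ⇒ C} {g : A ⇒ B} → f ≈ h → f ∘ g ≈ h ∘ g
  ∘-resp-≈ˡ p = ∘-resp-≈ p refl

  ∘-resp-≈ʳ : ∀ {A B C} {f : B ⇒ C} {g i : A ⇒ B} → g ≈ i → f ∘ g ≈ f ∘ i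
  ∘-resp-≈ʳ p = ∘-resp-≈ refl p

  pushˡ-square : ∀ {A B C D E} {a : A ⇒ B} {b : B ⇒ D} {c : A ⇒ C} {d : C ⇒ D}
                 {f : D ⇒ E} → b ∘ a ≈ d ∘ c → (f ∘ b) ∘ a ≈ (f ∘ d) ∘ c
  pushˡ-square p = trans assoc (trans (∘-resp-≈ʳ p) (sym assoc))

  split-epi-cancel : ∀ {A B C} {h : A ⇒ B} {k : B ⇒ A} → h ∘ k ≈ id
                   → {f f′ : B ⇒ C} → f ∘ h ≈ f′ ∘ h → f ≈ f′
  split-epi-cancel {h = h} {k} hk {f} {f′} p = begin
    f            ≈⟨ identityʳ ⟨
    f ∘ id       ≈⟨ ∘-resp-≈ʳ hk ⟨
    f ∘ (h ∘ k)  ≈⟨ assoc ⟨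
    (f ∘ h) ∘ k  ≈⟨ ∘-resp-≈ˡ p ⟩
    (f′ ∘ h) ∘ k ≈⟨ assoc ⟩
    f′ ∘ (h ∘ k) ≈⟨ ∘-resp-≈ʳ hk ⟩
    f′ ∘ id      ≈⟨ identityʳ ⟩
    f′           ∎

  ⊗-interchange : ∀ {A B C D} {f : A ⇒ B} {g : C ⇒ D}
                → (f ⊗₁ id) ∘ (id ⊗₁ g) ≈ (id ⊗₁ g) ∘ (f ⊗₁ id)
  ⊗-interchange {f = f} {g} = begin
    (f ⊗₁ id) ∘ (id ⊗₁ g) ≈⟨ ⊗-homomorphism ⟨
    (f ∘ id) ⊗₁ (id ∘ g)  ≈⟨ ⊗-resp-≈ (trans identityʳ (sym identityˡ))
                                      (trans identityˡ (sym identityʳ)) ⟩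
    (id ∘ f) ⊗₁ (g ∘ id)  ≈⟨ ⊗-homomorphism ⟩
    (id ⊗₁ g) ∘ (f ⊗₁ id) ∎

  ∘-⊗id : ∀ {A B C D} {f : B ⇒ C} {g : A ⇒ B} → (f ∘ g) ⊗₁ id {D} ≈ (f ⊗₁ id) ∘ (g ⊗₁ id)
  ∘-⊗id = trans (⊗-resp-≈ refl (sym identityˡ)) ⊗-homomorphism

  ρ⇐-natural : ∀ {A B} {f : A ⇒ B} → ρ⇐ ∘ f ≈ (f ⊗₁ id) ∘ ρ⇐
  ρ⇐-natural {f = f} = split-epi-cancel ρ-isoʳ (begin
    (ρ⇐ ∘ f) ∘ ρ⇒          ≈⟨ assoc ⟩
    ρ⇐ ∘ (f ∘ ρ⇒)          ≈⟨ ∘-resp-≈ʳ ρ-natural ⟨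
    ρ⇐ ∘ (ρ⇒ ∘ (f ⊗₁ id))  ≈⟨ assoc ⟨
    (ρ⇐ ∘ ρ⇒) ∘ (f ⊗₁ id)  ≈⟨ ∘-resp-≈ˡ ρ-isoˡ ⟩
    id ∘ (f ⊗₁ id)         ≈⟨ identityˡ ⟩
    f ⊗₁ id                ≈⟨ identityʳ ⟨
    (f ⊗₁ id) ∘ id         ≈⟨ ∘-resp-≈ʳ ρ-isoˡ ⟨
    (f ⊗₁ id) ∘ (ρ⇐ ∘ ρ⇒)  ≈⟨ assoc ⟨
    ((f ⊗₁ id) ∘ ρ⇐) ∘ ρ⇒  ∎)

  uncurry : ∀ {A B C} → (C ⇒ A ⊸ B) → (C ⊗₀ A ⇒ B)
  uncurry g = ev ∘ (g ⊗₁ id)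

  curry-resp-≈ : ∀ {A B C} {f f′ : C ⊗₀ A ⇒ B} → f ≈ f′ → curry f ≈ curry f′
  curry-resp-≈ p = curry-unique (trans curry-β p)

  curry-injective : ∀ {A B C} {f f′ : C ⊗₀ A ⇒ B} → curry f ≈ curry f′ → f ≈ f′
  curry-injective {f = f} {f′} p = begin
    f                    ≈⟨ curry-β ⟨
    uncurry (curry f)    ≈⟨ ∘-resp-≈ʳ (⊗-resp-≈ p refl) ⟩
    uncurry (curry f′)   ≈⟨ curry-β ⟩
    f′                   ∎

  uncurry-injective : ∀ {A B C} {g g′ : C ⇒ A ⊸ B} → uncurry g ≈ uncurry g′ → g ≈ g′
  uncurry-injective p = trans (curry-unique p) (sym (curry-unique refl))

  curry-∘ : ∀ {A B C C′} {f : C ⊗₀ A ⇒ B} {h : C′ ⇒ C} → curry f ∘ h ≈ curry (f ∘ (h ⊗₁ id))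
  curry-∘ {f = f} {h} = curry-unique (begin
    ev ∘ ((curry f ∘ h) ⊗₁ id)        ≈⟨ ∘-resp-≈ʳ ∘-⊗id ⟩
    ev ∘ ((curry f ⊗₁ id) ∘ (h ⊗₁ id)) ≈⟨ assoc ⟨
    uncurry (curry f) ∘ (h ⊗₁ id)     ≈⟨ ∘-resp-≈ˡ curry-β ⟩
    f ∘ (h ⊗₁ id)                     ∎)

  curry-σ-∘ : ∀ {A D X Z} {f : X ⊗₀ D ⇒ Z} {x : A ⇒ D}
            → curry (f ∘ σ) ∘ x ≈ curry ((f ∘ (id ⊗₁ x)) ∘ σ)
  curry-σ-∘ = trans curry-∘ (curry-resp-≈ (pushˡ-square σ-natural))

  evaluate-at-∘ : ∀ {D X Z} {x : unit ⇒ D} {g : Z ⇒ D ⊸ X}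
                → (ev ∘ ((id ⊗₁ x) ∘ ρ⇐)) ∘ g ≈ (uncurry g ∘ (id ⊗₁ x)) ∘ ρ⇐
  evaluate-at-∘ {x = x} {g} = begin
    (ev ∘ ((id ⊗₁ x) ∘ ρ⇐)) ∘ g           ≈⟨ trans assoc (∘-resp-≈ʳ assoc) ⟩
    ev ∘ ((id ⊗₁ x) ∘ (ρ⇐ ∘ g))           ≈⟨ ∘-resp-≈ʳ (∘-resp-≈ʳ ρ⇐-natural) ⟩
    ev ∘ ((id ⊗₁ x) ∘ ((g ⊗₁ id) ∘ ρ⇐))   ≈⟨ ∘-resp-≈ʳ assoc ⟨
    ev ∘ (((id ⊗₁ x) ∘ (g ⊗₁ id)) ∘ ρ⇐)   ≈⟨ ∘-resp-≈ʳ (∘-resp-≈ˡ ⊗-interchange) ⟨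
    ev ∘ (((g ⊗₁ id) ∘ (id ⊗₁ x)) ∘ ρ⇐)   ≈⟨ assoc ⟨
    (ev ∘ ((g ⊗₁ id) ∘ (id ⊗₁ x))) ∘ ρ⇐   ≈⟨ ∘-resp-≈ˡ assoc ⟨
    (uncurry g ∘ (id ⊗₁ x)) ∘ ρ⇐          ∎

  module _ (D : Obj) (ι : ℕ → unit ⇒ D) where

    epic⇒⊗-epic : JointlyEpic 𝒞 ι → ∀ X → JointlyEpic 𝒞 (λ i → id {X} ⊗₁ ι i)
    epic⇒⊗-epic ι-epic X f f′ eq =
      split-epi-cancel σ-involutive (curry-injective (ι-epic _ _ λ i → begin
        curry (f ∘ σ) ∘ ι i               ≈⟨ curry-σ-∘ ⟩
        curry ((f ∘ (id ⊗₁ ι i)) ∘ σ)     ≈⟨ curry-resp-≈ (∘-resp-≈ˡ (eq i)) ⟩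
        curry ((f′ ∘ (id ⊗₁ ι i)) ∘ σ)    ≈⟨ curry-σ-∘ ⟨
        curry (f′ ∘ σ) ∘ ι i              ∎))

    ⊗-epic⇒epic : (∀ X → JointlyEpic 𝒞 (λ i → id {X} ⊗₁ ι i)) → JointlyEpic 𝒞 ι
    ⊗-epic⇒epic ⊗-epic f f′ eq =
      split-epi-cancel λ-isoʳ (⊗-epic unit _ _ λ i → begin
        (f ∘ λ⇒) ∘ (id ⊗₁ ι i)    ≈⟨ pushˡ-square λ-natural ⟩
        (f ∘ ι i) ∘ λ⇒            ≈⟨ ∘-resp-≈ˡ (eq i) ⟩
        (f′ ∘ ι i) ∘ λ⇒           ≈⟨ pushˡ-square λ-natural ⟨
        (f′ ∘ λ⇒) ∘ (id ⊗₁ ι i)   ∎)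

    ⊗-epic⇒π-monic : (∀ X → JointlyEpic 𝒞 (λ i → id {X} ⊗₁ ι i))
                   → ∀ X → JointlyMonic 𝒞 (π 𝒞 X ι)
    ⊗-epic⇒π-monic ⊗-epic X {Z} g g′ eq =
      uncurry-injective (⊗-epic Z _ _ λ i → split-epi-cancel ρ-isoˡ (begin
        (uncurry g ∘ (id ⊗₁ ι i)) ∘ ρ⇐    ≈⟨ evaluate-at-∘ ⟨
        π 𝒞 X ι i ∘ g                     ≈⟨ eq i ⟩
        π 𝒞 X ι i ∘ g′                    ≈⟨ evaluate-at-∘ ⟩
        (uncurry g′ ∘ (id ⊗₁ ι i)) ∘ ρ⇐   ∎))

    π-monic⇒⊗-epic : (∀ X → JointlyMonic 𝒞 (π 𝒞 X ι))
                   → ∀ X → JointlyEpic 𝒞 (λ i → id {X} ⊗₁ ι i)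
    π-monic⇒⊗-epic π-monic X {Z} f f′ eq =
      curry-injective (π-monic Z _ _ λ i → begin
        π 𝒞 Z ι i ∘ curry f                     ≈⟨ evaluate-at-∘ ⟩
        (uncurry (curry f) ∘ (id ⊗₁ ι i)) ∘ ρ⇐  ≈⟨ ∘-resp-≈ˡ (trans (∘-resp-≈ˡ curry-β) (eq i)) ⟩
        (f′ ∘ (id ⊗₁ ι i)) ∘ ρ⇐                 ≈⟨ ∘-resp-≈ˡ (∘-resp-≈ˡ curry-β) ⟨
        (uncurry (curry f′) ∘ (id ⊗₁ ι i)) ∘ ρ⇐ ≈⟨ evaluate-at-∘ ⟨
        π 𝒞 Z ι i ∘ curry f′                    ∎)

lemma6p3 : ∀ {o ℓ e} (𝒞 : SymmetricMonoidalClosedCategory o ℓ e) → ZeroMorphisms 𝒞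
    → let open SymmetricMonoidalClosedCategory 𝒞 in
    (D : Obj) (ι : ℕ → unit ⇒ D)
    → (JointlyEpic 𝒞 ι ⇔ (∀ (X : Obj) → JointlyEpic 𝒞 (λ i → id {X} ⊗₁ ι i)))
    × (JointlyEpic 𝒞 ι ⇔ (∀ (X : Obj) → JointlyMonic 𝒞 (π 𝒞 X ι)))
lemma6p3 𝒞 _ D ι = epic⇔⊗-epic , ⇔.trans epic⇔⊗-epic ⊗-epic⇔π-monic
  where
  open Properties 𝒞
  epic⇔⊗-epic = mk⇔ (epic⇒⊗-epic D ι) (⊗-epic⇒epic D ι)
  ⊗-epic⇔π-monic = mk⇔ (⊗-epic⇒π-monic D ι) (π-monic⇒⊗-epic D ι)
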